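{- For every inversion sequence $\sigma$ avoiding $201$ and $210$, let $s(\sigma)=\ell(\sigma)+\chi(R(\sigma)\neq\emptyset)$. Then $s(\varepsilon)=0$, and for every inversion sequence $\sigma$ avoiding $201$ and $210$, with $s=s(\sigma)$, the multiset $\{\!\{ s(\tau) : \tau \text{ a child of } \sigma \text{ avoiding } 201 \text{ and } 210\}\!\}$ consists of each value $i\in[1,s+1]$ with multiplicity one, together with each value $i+1$, for $i\in[1,s-1]$, with additional multiplicity $2^{s-i}-1$. In other words, the generating tree growing on the left restricted to inversion sequences avoiding $201$ and $210$ (rooted at the empty sequence $\varepsilon$) is isomorphic, via $\sigma\mapsto s(\sigma)$, to the tree generated by the succession rule with axiom $(0)$ and productions $(s)\leadsto (i)$ for $i\in[1,s+1]$ and $(s)\leadsto (i+1)^{2^{s-i}-1}$ for $i\in[1,s-1]$.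
   Context: An inversion sequence of size $n$ is a sequence $\sigma=(\sigma_1,\dots,\sigma_n)$ of integers with $\sigma_i\in\{0,\dots,i-1\}$; $\varepsilon$ is the empty sequence. A sequence contains the pattern $201$ (resp. $210$) if it has entries at positions $a<b<c$ with $\sigma_b<\sigma_c<\sigma_a$ (resp. $\sigma_c<\sigma_b<\sigma_a$); otherwise it avoids it. $\mathbf{Zeros}(\sigma)$ is the set of positions of zero entries; $L(\sigma)=\{i : \sigma_j=0 \text{ for all } j\leqslant i\}$ is the set of leading zeros, $\ell(\sigma)=|L(\sigma)|$, $R(\sigma)=\mathbf{Zeros}(\sigma)\setminus L(\sigma)$; $\chi$ is the indicator of a statement. The children of $\sigma$ (size $n$) in the generating tree growing on the left are the sequences $\mathbf{child}(\sigma,Z)=0\cdot(\sigma_i+\chi(\sigma_i>0)+\chi(i\in Z))_{i\in[1,n]}$, $Z\subseteq\mathbf{Zeros}(\sigma)$ (distinct $Z$ give distinct children). In a succession rule, $(s)\leadsto (j)^m$ means a node labelled $(s)$ has $m$ children labelled $(j)$. -}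

module Defs where

import Data.Nat
open import Data.Nat using (ℕ; zero; suc; _+_; _∸_; _^_; _≤_; _<_)
open import Data.Nat.Properties using (_≟_; _<?_)
open import Data.Bool using (Bool; true; false; T)
open import Data.Fin using (Fin; toℕ)
import Data.Fin as Fin
open import Data.Fin.Properties using (any?)
open import Data.Vec using (Vec; []; _∷_; lookup; tabulate)
open import Data.List using (List; []; _∷_; map; filter; upTo; concatMap; replicate; _++_)
open import Data.Product using (∃; Σ; _×_; _,_)
open import Relation.Nullary using (¬_; Dec; yes; no; ¬?)
open import Relation.Nullary.Decidable using (_×-dec_; isYes)
open import Relation.Binary.PropositionalEquality using (_≡_)

χ : ∀ {p} {P : Set p} → Dec P → ℕ
χ (yes _) = 1
χ (no _)  = 0

-- A sequence of size n is a Vec ℕ n; position i (0-based Fin n) holds σ_{i+1}.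
-- Inversion sequence: σ_i ∈ {0,…,i-1} for 1-based i, i.e. lookup σ i ≤ toℕ i.
IsInversionSequence : ∀ {n} → Vec ℕ n → Set
IsInversionSequence σ = ∀ i → lookup σ i ≤ toℕ i

Contains201 : ∀ {n} → Vec ℕ n → Set
Contains201 {n} σ = ∃ λ (a : Fin n) → ∃ λ (b : Fin n) → ∃ λ (c : Fin n) →
  (toℕ a < toℕ b × toℕ b < toℕ c) × (lookup σ b < lookup σ c × lookup σ c < lookup σ a)

Contains210 : ∀ {n} → Vec ℕ n → Set
Contains210 {n} σ = ∃ λ (a : Fin n) → ∃ λ (b : Fin n) → ∃ λ (c : Fin n) →
  (toℕ a < toℕ b × toℕ b < toℕ c) × (lookup σ c < lookup σ b × lookup σ b < lookup σ a)

Avoids201and210 : ∀ {n} → Vec ℕ n → Set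
Avoids201and210 σ = ¬ Contains201 σ × ¬ Contains210 σ

contains201? : ∀ {n} (σ : Vec ℕ n) → Dec (Contains201 σ)
contains201? σ = any? λ a → any? λ b → any? λ c →
  ((toℕ a <? toℕ b) ×-dec (toℕ b <? toℕ c)) ×-dec
  ((lookup σ b <? lookup σ c) ×-dec (lookup σ c <? lookup σ a))

contains210? : ∀ {n} (σ : Vec ℕ n) → Dec (Contains210 σ)
contains210? σ = any? λ a → any? λ b → any? λ c →
  ((toℕ a <? toℕ b) ×-dec (toℕ b <? toℕ c)) ×-dec
  ((lookup σ c <? lookup σ b) ×-dec (lookup σ b <? lookup σ a))

avoids201and210? : ∀ {n} (σ : Vec ℕ n) → Dec (Avoids201and210 σ)
avoids201and210? σ = ¬? (contains201? σ) ×-dec ¬? (contains210? σ)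

-- ℓ(σ) = |L(σ)|, L(σ) = {i : σ_j = 0 for all j ≤ i}: the length of the
-- maximal prefix of zeros.
ℓ : ∀ {n} → Vec ℕ n → ℕ
ℓ []           = 0
ℓ (zero ∷ σ)   = suc (ℓ σ)
ℓ (suc _ ∷ σ)  = 0

-- i ∈ R(σ) = Zeros(σ) \ L(σ): σ_i = 0 and some j ≤ i has σ_j ≠ 0.
InR : ∀ {n} → Vec ℕ n → Fin n → Set
InR {n} σ i = lookup σ i ≡ 0 × ∃ λ (j : Fin n) → toℕ j ≤ toℕ i × ¬ (lookup σ j ≡ 0)

RNonempty : ∀ {n} → Vec ℕ n → Set
RNonempty σ = ∃ λ i → InR σ i

RNonempty? : ∀ {n} (σ : Vec ℕ n) → Dec (RNonempty σ)
RNonempty? σ = any? λ i → (lookup σ i ≟ 0) ×-dec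
  (any? λ j → (toℕ j Data.Nat.≤? toℕ i) ×-dec ¬? (lookup σ j ≟ 0))

s : ∀ {n} → Vec ℕ n → ℕ
s σ = ℓ σ + χ (RNonempty? σ)

-- Subsets Z of positions [1,n], as characteristic vectors.
allSubsets : ∀ n → List (Vec Bool n)
allSubsets zero    = [] ∷ []
allSubsets (suc n) = map (false ∷_) (allSubsets n) ++ map (true ∷_) (allSubsets n)

SubsetOfZeros : ∀ {n} → Vec ℕ n → Vec Bool n → Set
SubsetOfZeros {n} σ Z = ∀ (i : Fin n) → lookup Z i ≡ true → lookup σ i ≡ 0

subsetOfZeros? : ∀ {n} (σ : Vec ℕ n) (Z : Vec Bool n) → Dec (SubsetOfZeros σ Z)
subsetOfZeros? [] [] = yes λ ()
subsetOfZeros? (x ∷ σ) (false ∷ Z) with subsetOfZeros? σ Z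
... | yes p = yes λ { Fin.zero () ; (Fin.suc i) e → p i e }
... | no ¬p = no λ q → ¬p (λ i e → q (Fin.suc i) e)
subsetOfZeros? (zero ∷ σ) (true ∷ Z) with subsetOfZeros? σ Z
... | yes p = yes λ { Fin.zero _ → _≡_.refl ; (Fin.suc i) e → p i e }
... | no ¬p = no λ q → ¬p (λ i e → q (Fin.suc i) e)
subsetOfZeros? (suc x ∷ σ) (true ∷ Z) = no λ q → h (q Fin.zero _≡_.refl)
  where
  h : ¬ (suc x ≡ 0)
  h ()

bit : Bool → ℕ
bit true  = 1
bit false = 0

child : ∀ {n} → Vec ℕ n → Vec Bool n → Vec ℕ (suc n)
child {n} σ Z = 0 ∷ tabulate (λ i → lookup σ i + χ (0 <? lookup σ i) + bit (lookup Z i))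

-- All children of σ in the generating tree growing on the left
-- (one for each Z ⊆ Zeros(σ); distinct Z give distinct children).
children : ∀ {n} → Vec ℕ n → List (Vec ℕ (suc n))
children σ = map (child σ) (filter (subsetOfZeros? σ) (allSubsets _))

avoidingChildren : ∀ {n} → Vec ℕ n → List (Vec ℕ (suc n))
avoidingChildren σ = filter avoids201and210? (children σ)

production : ℕ → List ℕ
production k = map suc (upTo (suc k))
  ++ concatMap (λ i → replicate (2 ^ (k ∸ i) ∸ 1) (suc i)) (map suc (upTo (k ∸ 1)))

{-# OPTIONS --safe #-}
module Submission where

-- The child 0 ∷ τ of σ for Z raises the nonzero entries of σ by one, turns the zeros in Z into 1
-- and keeps the other zeros. Strict comparisons between entries of σ persist in τ and the only new
-- ones are 0 < 1 between two zeros, so when σ avoids 201 and 210, τ contains one of the patterns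
-- iff some nonzero entry of σ precedes both a zero in Z and a zero outside Z. The admissible Z are
-- therefore free on the leading zeros of σ and mark either all or none of its other zeros.
-- Induct on the first entry of σ. If it is 0, the Z omitting that position give the children of
-- the tail with labels raised by one, while those containing it give one child labelled 1 (Z marks
-- every later zero) and 2 ^ s - 1 children labelled 2: exactly how the production of s + 1 arises
-- from that of s. If it is nonzero, the children are labelled 1 and, when a zero follows, 2.

open import Defs
open import Data.Nat using (ℕ)
open import Data.Vec using (Vec; [])
open import Data.List using (map)
open import Data.Product using (_×_)
open import Relation.Binary.PropositionalEquality using (_≡_)
open import Data.List.Relation.Binary.Permutation.Propositional using (_↭_)

open import Data.Bool using (Bool; true; false; not)
open import Data.Bool.Properties using (¬-not; not-involutive)
import Data.Bool.Properties as Bool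
open import Data.Empty using (⊥)
open import Data.Fin using (Fin; toℕ) renaming (zero to fzero; suc to fsuc)
open import Data.Fin.Properties using (any?; <-cmp)
open import Data.List using (List; []; _∷_; _++_; filter; replicate; upTo; concatMap)
open import Data.List.Properties
  using (filter-++; filter-≐; filter-none; ++-identityʳ; map-++; map-∘; map-cong; map-replicate;
         map-applyUpTo; concatMap-map; concatMap-cong; map-concatMap)
open import Data.List.Relation.Binary.Permutation.Propositional
  using (↭-refl; prep; swap; module PermutationReasoning)
open import Data.List.Relation.Binary.Permutation.Propositional.Properties
  using (++⁺; ++-comm; shift; shifts; map⁺)
import Data.List.Relation.Unary.All as All
open import Data.Nat using (zero; suc; _+_; _∸_; _^_; _<_; z≤n; s≤s)
open import Data.Nat.Properties
  using (_≟_; _<?_; n≮0; m^n>0; <-trans; ≤-trans; ≤-pred; m≤n+m; m≤m+n; +-suc; +-identityʳ; +-comm)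
open import Data.Product using (∃; _,_; proj₁; proj₂; uncurry)
open import Data.Sum using (_⊎_; inj₁; inj₂; [_,_]; map₂) renaming (map to map-⊎)
open import Data.Unit using (⊤; tt)
open import Data.Vec using (_∷_; lookup; tabulate)
open import Data.Vec.Properties using (≡-dec; lookup∘tabulate; ∷-injectiveˡ; ∷-injectiveʳ)
open import Function using (_∘_; id; _⇔_; mk⇔; Equivalence)
open import Relation.Binary.Definitions using (Tri; tri<; tri≈; tri>)
open import Relation.Binary.PropositionalEquality
  using (_≢_; refl; sym; trans; cong; cong₂; subst; subst₂; module ≡-Reasoning)
open import Relation.Nullary using (Dec; does; yes; no; ¬_; contradiction)
open import Relation.Nullary.Decidable using (_×-dec_; _⊎-dec_)
open import Relation.Unary using (Pred; Decidable; _≐_; _∩_)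
open import Relation.Unary.Properties using (_∩?_)

private
  variable
    n : ℕ
    x : ℕ
    b c c′ : Bool
    σ : Vec ℕ n
    Z : Vec Bool n

module _ {a b p} {A : Set a} {B : Set b} {P : Pred B p} (P? : Decidable P) (f : A → B) where

  filter-map : ∀ xs → filter P? (map f xs) ≡ map f (filter (P? ∘ f) xs)
  filter-map []       = refl
  filter-map (y ∷ ys) with does (P? (f y))
  ... | true  = cong (f y ∷_) (filter-map ys)
  ... | false = filter-map ys

module _ {a p q} {A : Set a} {P : Pred A p} {Q : Pred A q} (P? : Decidable P) (Q? : Decidable Q) where

  filter-filter : ∀ xs → filter Q? (filter P? xs) ≡ filter (P? ∩? Q?) xs
  filter-filter []       = refl
  filter-filter (y ∷ ys) with does (P? y)
  ... | false = filter-filter ys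
  ... | true with does (Q? y)
  ...   | true  = cong (y ∷_) (filter-filter ys)
  ...   | false = filter-filter ys

module _ {n p} {P : Pred (Vec Bool (suc n)) p} (P? : Decidable P) where

  filter-allSubsets : filter P? (allSubsets (suc n)) ≡
    map (false ∷_) (filter (P? ∘ (false ∷_)) (allSubsets n)) ++
    map (true ∷_) (filter (P? ∘ (true ∷_)) (allSubsets n))
  filter-allSubsets = trans (filter-++ P? (map (false ∷_) S) (map (true ∷_) S))
    (cong₂ _++_ (filter-map P? (false ∷_) S) (filter-map P? (true ∷_) S))
    where S = allSubsets n

  filter-allSubsets-false : (∀ Z → ¬ P (true ∷ Z)) →
    filter P? (allSubsets (suc n)) ≡ map (false ∷_) (filter (P? ∘ (false ∷_)) (allSubsets n))
  filter-allSubsets-false ¬P = trans filter-allSubsets (trans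
    (cong (λ ys → map (false ∷_) (filter (P? ∘ (false ∷_)) S) ++ map (true ∷_) ys)
          (filter-none (P? ∘ (true ∷_)) (All.universal ¬P S)))
    (++-identityʳ _))
    where S = allSubsets n

infix 4 _≟ᵥ_
_≟ᵥ_ : (Z Y : Vec Bool n) → Dec (Z ≡ Y)
_≟ᵥ_ = ≡-dec Bool._≟_

filter-≟-allSubsets : (v : Vec Bool n) → filter (_≟ᵥ v) (allSubsets n) ≡ v ∷ []
filter-≟-∷ : ∀ b (v : Vec Bool n) → filter (λ Z → b ∷ Z ≟ᵥ b ∷ v) (allSubsets n) ≡ v ∷ []
filter-≟-∷-mismatch : ∀ {b b′} (v : Vec Bool n) → b ≢ b′ →
  filter (λ Z → b ∷ Z ≟ᵥ b′ ∷ v) (allSubsets n) ≡ []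

filter-≟-allSubsets []          = refl
filter-≟-allSubsets (false ∷ v) = trans (filter-allSubsets (_≟ᵥ false ∷ v))
  (cong₂ (λ xs ys → map (false ∷_) xs ++ map (true ∷_) ys)
         (filter-≟-∷ false v) (filter-≟-∷-mismatch v λ ()))
filter-≟-allSubsets (true ∷ v)  = trans (filter-allSubsets (_≟ᵥ true ∷ v))
  (cong₂ (λ xs ys → map (false ∷_) xs ++ map (true ∷_) ys)
         (filter-≟-∷-mismatch v λ ()) (filter-≟-∷ true v))

filter-≟-∷ {n} b v = trans
  (filter-≐ (λ Z → b ∷ Z ≟ᵥ b ∷ v) (_≟ᵥ v) (∷-injectiveʳ , cong (b ∷_)) (allSubsets n))
  (filter-≟-allSubsets v)

filter-≟-∷-mismatch {n} {b} {b′} v b≢b′ =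
  filter-none (λ Z → b ∷ Z ≟ᵥ b′ ∷ v)
              (All.universal (λ _ → b≢b′ ∘ ∷-injectiveˡ) (allSubsets n))

map-fusion : ∀ {a b c} {A : Set a} {B : Set b} {C : Set c} {f : B → C} {g : A → B} {h : A → C} →
  (∀ x → f (g x) ≡ h x) → ∀ xs → map f (map g xs) ≡ map h xs
map-fusion f∘g≗h xs = trans (sym (map-∘ xs)) (map-cong f∘g≗h xs)

++-replicate : ∀ {a} {A : Set a} m n (y : A) → replicate m y ++ replicate n y ≡ replicate (m + n) y
++-replicate zero    n y = refl
++-replicate (suc m) n y = cong (y ∷_) (++-replicate m n y)

χ-⇔ : ∀ {a b} {A : Set a} {B : Set b} → A ⇔ B → (a? : Dec A) (b? : Dec B) → χ a? ≡ χ b?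
χ-⇔ _   (yes _) (yes _) = refl
χ-⇔ _   (no _)  (no _)  = refl
χ-⇔ A⇔B (yes a) (no ¬b) = contradiction (Equivalence.to A⇔B a) ¬b
χ-⇔ A⇔B (no ¬a) (yes b) = contradiction (Equivalence.from A⇔B b) ¬a

χ-yes : ∀ {a} {A : Set a} → A → (a? : Dec A) → χ a? ≡ 1
χ-yes _ (yes _) = refl
χ-yes a (no ¬a) = contradiction a ¬a

production-χ : ∀ {a} {A : Set a} (a? : Dec A) → production (χ a?) ≡ 1 ∷ replicate (χ a?) 2
production-χ (yes _) = refl
production-χ (no _)  = refl

2^suc∸1 : ∀ k → 2 ^ suc k ∸ 1 ≡ suc (2 ^ k ∸ 1) + (2 ^ k ∸ 1)
2^suc∸1 k = double∸1 (2 ^ k) (m^n>0 2 k)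
  where
  double∸1 : ∀ p → 0 < p → p + (p + 0) ∸ 1 ≡ suc (p ∸ 1) + (p ∸ 1)
  double∸1 (suc m) _ = trans (+-suc m (m + 0)) (cong (suc ∘ (m +_)) (+-identityʳ m))

2^χ∸1 : ∀ {a} {A : Set a} (a? : Dec A) → 2 ^ χ a? ∸ 1 ≡ χ a?
2^χ∸1 (yes _) = refl
2^χ∸1 (no _)  = refl

upTo-suc : ∀ n → upTo (suc n) ≡ 0 ∷ map suc (upTo n)
upTo-suc n = cong (0 ∷_) (sym (map-applyUpTo id suc n))

extraLabels : ℕ → List ℕ
extraLabels k = concatMap (λ i → replicate (2 ^ (k ∸ i) ∸ 1) (suc i)) (map suc (upTo (k ∸ 1)))

extraLabels-suc : ∀ k → extraLabels (suc k) ≡ replicate (2 ^ k ∸ 1) 2 ++ map suc (extraLabels k)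
extraLabels-suc zero    = refl
extraLabels-suc (suc t) = begin
    concatMap G (map suc (upTo (suc t)))
  ≡⟨ cong (concatMap G ∘ map suc) (upTo-suc t) ⟩
    G 1 ++ concatMap G (map suc W)
  ≡⟨ cong (G 1 ++_) (concatMap-map G suc W) ⟩
    G 1 ++ concatMap (G ∘ suc) W
  ≡⟨ cong (G 1 ++_) (concatMap-cong (λ i → sym (map-replicate suc _ (suc i))) W) ⟩
    G 1 ++ concatMap (map suc ∘ H) W
  ≡⟨ cong (G 1 ++_) (sym (map-concatMap suc H W)) ⟩
    G 1 ++ map suc (concatMap H W) ∎
  where
  open ≡-Reasoning
  G H : ℕ → List ℕ
  G i = replicate (2 ^ (suc (suc t) ∸ i) ∸ 1) (suc i)
  H i = replicate (2 ^ (suc t ∸ i) ∸ 1) (suc i)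
  W = map suc (upTo t)

production-suc : ∀ k → map suc (production k) ++ 1 ∷ replicate (2 ^ k ∸ 1) 2 ↭ production (suc k)
production-suc k = begin
    map suc (ascending ++ extraLabels k) ++ 1 ∷ r
  ≡⟨ cong (_++ 1 ∷ r) (map-++ suc ascending (extraLabels k)) ⟩
    (map suc ascending ++ map suc (extraLabels k)) ++ 1 ∷ r
  ↭⟨ ++-comm (map suc ascending ++ map suc (extraLabels k)) (1 ∷ r) ⟩
    1 ∷ r ++ map suc ascending ++ map suc (extraLabels k)
  ↭⟨ prep 1 (shifts r (map suc ascending)) ⟩
    1 ∷ map suc ascending ++ r ++ map suc (extraLabels k)
  ≡⟨ sym (cong₂ _++_ (cong (map suc) (upTo-suc (suc k))) (extraLabels-suc k)) ⟩
    production (suc k) ∎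
  where
  open PermutationReasoning
  ascending = map suc (upTo (suc k))
  r = replicate (2 ^ k ∸ 1) 2

HasZero : Vec ℕ n → Set
HasZero σ = ∃ λ i → lookup σ i ≡ 0

hasZero? : (σ : Vec ℕ n) → Dec (HasZero σ)
hasZero? σ = any? λ i → lookup σ i ≟ 0

hasZero-suc∷ : HasZero (suc x ∷ σ) ⇔ HasZero σ
hasZero-suc∷ = mk⇔ (λ { (fsuc i , z) → i , z }) (λ (i , z) → fsuc i , z)

χ-hasZero-suc∷ : ∀ (σ : Vec ℕ n) → χ (hasZero? (suc x ∷ σ)) ≡ χ (hasZero? σ)
χ-hasZero-suc∷ σ = χ-⇔ hasZero-suc∷ (hasZero? (suc _ ∷ σ)) (hasZero? σ)

χ-hasZero-zero∷ : ∀ (σ : Vec ℕ n) → χ (hasZero? (0 ∷ σ)) ≡ 1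
χ-hasZero-zero∷ σ = χ-yes (fzero , refl) (hasZero? (0 ∷ σ))

rNonempty-zero∷ : RNonempty (0 ∷ σ) ⇔ RNonempty σ
rNonempty-zero∷ = mk⇔
  (λ { (fzero , _ , fzero , _ , σj≢0) → contradiction refl σj≢0
     ; (fsuc i , _ , fzero , _ , σj≢0) → contradiction refl σj≢0
     ; (fsuc i , σi≡0 , fsuc j , s≤s j≤i , σj≢0) → i , σi≡0 , j , j≤i , σj≢0 })
  (λ (i , σi≡0 , j , j≤i , σj≢0) → fsuc i , σi≡0 , fsuc j , s≤s j≤i , σj≢0)

rNonempty-suc∷ : RNonempty (suc x ∷ σ) ⇔ HasZero σ
rNonempty-suc∷ = mk⇔ (λ { (fsuc i , σi≡0 , _) → i , σi≡0 })
                     (λ (i , σi≡0) → fsuc i , σi≡0 , fzero , z≤n , λ ())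

s-zero∷ : ∀ (σ : Vec ℕ n) → s (0 ∷ σ) ≡ suc (s σ)
s-zero∷ σ = cong (suc (ℓ σ) +_) (χ-⇔ rNonempty-zero∷ (RNonempty? (0 ∷ σ)) (RNonempty? σ))

s-suc∷ : ∀ (σ : Vec ℕ n) → s (suc x ∷ σ) ≡ χ (hasZero? σ)
s-suc∷ σ = χ-⇔ rNonempty-suc∷ (RNonempty? (suc _ ∷ σ)) (hasZero? σ)

childEntry : ℕ → Bool → ℕ
childEntry x b = x + χ (0 <? x) + bit b

childTail : Vec ℕ n → Vec Bool n → Vec ℕ n
childTail σ Z = tabulate λ i → childEntry (lookup σ i) (lookup Z i)

lookup-childTail : ∀ (σ : Vec ℕ n) Z i →
  lookup (childTail σ Z) i ≡ childEntry (lookup σ i) (lookup Z i)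
lookup-childTail σ Z = lookup∘tabulate _

-- childTail σ Z has a zero exactly where σ has a zero outside Z.
missesZero : Vec ℕ n → Vec Bool n → ℕ
missesZero σ Z = χ (hasZero? (childTail σ Z))

s-child-zero∷-true : ∀ (σ : Vec ℕ n) Z → s (child (0 ∷ σ) (true ∷ Z)) ≡ suc (missesZero σ Z)
s-child-zero∷-true σ Z = trans (s-zero∷ (1 ∷ childTail σ Z)) (cong suc (s-suc∷ (childTail σ Z)))

s-child-suc∷ : ∀ (σ : Vec ℕ n) Z → s (child (suc x ∷ σ) (b ∷ Z)) ≡ suc (missesZero σ Z)
s-child-suc∷ {x = x} {b = b} σ Z =
  trans (s-zero∷ (childEntry (suc x) b ∷ childTail σ Z)) (cong suc (s-suc∷ (childTail σ Z)))

childEntry-suc : ∀ x → childEntry (suc x) false ≡ suc (suc x)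
childEntry-suc x = cong suc (trans (+-identityʳ (x + 1)) (+-comm x 1))

childEntry-nonzero : ∀ x b → 0 < x → 1 < childEntry x b
childEntry-nonzero (suc x) b _ = s≤s (≤-trans (m≤n+m 1 x) (m≤m+n (x + 1) (bit b)))

childEntry-<-reflect : ∀ x y b c → (b ≡ true → x ≡ 0) → (c ≡ true → y ≡ 0) →
  childEntry x b < childEntry y c → x < y ⊎ (x ≡ 0 × b ≡ false) × (y ≡ 0 × c ≡ true)
childEntry-<-reflect zero    zero    false false _   _   ()
childEntry-<-reflect zero    zero    false true  _   _   _  = inj₂ ((refl , refl) , (refl , refl))
childEntry-<-reflect zero    zero    true  false _   _   ()
childEntry-<-reflect zero    zero    true  true  _   _   (s≤s ())
childEntry-<-reflect zero    (suc y) _     _     _   _   _  = inj₁ (s≤s z≤n)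
childEntry-<-reflect (suc x) _       true  _     x≡0 _   _  = contradiction (x≡0 refl) λ ()
childEntry-<-reflect (suc x) zero    false false _   _   ()
childEntry-<-reflect (suc x) zero    false true  _   _   (s≤s ())
childEntry-<-reflect (suc x) (suc y) false true  _   y≡0 _  = contradiction (y≡0 refl) λ ()
childEntry-<-reflect (suc x) (suc y) false false _   _   lt =
  inj₁ (≤-pred (subst₂ _<_ (childEntry-suc x) (childEntry-suc y) lt))

MarkedZero : Bool → Vec ℕ n → Vec Bool n → Fin n → Set
MarkedZero c σ Z i = lookup σ i ≡ 0 × lookup Z i ≡ c

HasMarkedZero : Bool → Vec ℕ n → Vec Bool n → Set
HasMarkedZero c σ Z = ∃ (MarkedZero c σ Z)

hasMarkedZero? : ∀ c (σ : Vec ℕ n) Z → Dec (HasMarkedZero c σ Z)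
hasMarkedZero? c σ Z = any? λ i → (lookup σ i ≟ 0) ×-dec (lookup Z i Bool.≟ c)

MixedAfterNonzero : Vec ℕ n → Vec Bool n → Set
MixedAfterNonzero {n} σ Z = ∃ λ (a : Fin n) → ∃ λ (t : Fin n) → ∃ λ (f : Fin n) →
  (toℕ a < toℕ t × toℕ a < toℕ f) × 0 < lookup σ a ×
  MarkedZero true σ Z t × MarkedZero false σ Z f

module _ {n} {σ : Vec ℕ n} {Z : Vec Bool n} where

  childTail-unmarked : ∀ {i} → MarkedZero false σ Z i → lookup (childTail σ Z) i ≡ 0
  childTail-unmarked {i} (σi≡0 , Zi≡false) =
    trans (lookup-childTail σ Z i) (cong₂ childEntry σi≡0 Zi≡false)

  childTail-marked : ∀ {i} → MarkedZero true σ Z i → lookup (childTail σ Z) i ≡ 1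
  childTail-marked {i} (σi≡0 , Zi≡true) =
    trans (lookup-childTail σ Z i) (cong₂ childEntry σi≡0 Zi≡true)

  childTail-nonzero : ∀ {i} → 0 < lookup σ i → 1 < lookup (childTail σ Z) i
  childTail-nonzero {i} 0<σi =
    subst (1 <_) (sym (lookup-childTail σ Z i)) (childEntry-nonzero _ (lookup Z i) 0<σi)

  mixed⇒child-pattern : MixedAfterNonzero σ Z → Contains201 (child σ Z) ⊎ Contains210 (child σ Z)
  mixed⇒child-pattern (a , t , f , (a<t , a<f) , 0<σa , t-marked , f-unmarked) = by-order (<-cmp t f)
    where
    τf<τt : lookup (childTail σ Z) f < lookup (childTail σ Z) t
    τf<τt = subst₂ _<_ (sym (childTail-unmarked f-unmarked)) (sym (childTail-marked t-marked)) (s≤s z≤n)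
    τt<τa : lookup (childTail σ Z) t < lookup (childTail σ Z) a
    τt<τa = subst (_< lookup (childTail σ Z) a) (sym (childTail-marked t-marked)) (childTail-nonzero 0<σa)
    by-order : Tri (toℕ t < toℕ f) (t ≡ f) (toℕ f < toℕ t) →
               Contains201 (child σ Z) ⊎ Contains210 (child σ Z)
    by-order (tri< t<f _ _) = inj₂ (fsuc a , fsuc t , fsuc f , (s≤s a<t , s≤s t<f) , τf<τt , τt<τa)
    by-order (tri≈ _ t≡f _) =
      contradiction (trans (sym (proj₂ t-marked)) (trans (cong (lookup Z) t≡f) (proj₂ f-unmarked))) λ ()
    by-order (tri> _ _ f<t) = inj₁ (fsuc a , fsuc f , fsuc t , (s≤s a<f , s≤s f<t) , τf<τt , τt<τa)

  module _ (Z⊆0 : SubsetOfZeros σ Z) where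

    childTail-<-reflect : ∀ i j → lookup (childTail σ Z) i < lookup (childTail σ Z) j →
      lookup σ i < lookup σ j ⊎ MarkedZero false σ Z i × MarkedZero true σ Z j
    childTail-<-reflect i j τi<τj = childEntry-<-reflect _ _ _ _ (Z⊆0 i) (Z⊆0 j)
      (subst₂ _<_ (lookup-childTail σ Z i) (lookup-childTail σ Z j) τi<τj)

    child-201 : Contains201 (child σ Z) → Contains201 σ ⊎ MixedAfterNonzero σ Z
    child-201 (fzero , _ , _ , _ , _ , ())
    child-201 (fsuc _ , fzero , _ , (() , _) , _)
    child-201 (fsuc _ , fsuc _ , fzero , (_ , ()) , _)
    child-201 (fsuc a , fsuc b , fsuc c , (s≤s a<b , s≤s b<c) , τb<τc , τc<τa)
      with childTail-<-reflect c a τc<τa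
    ... | inj₂ (c-unmarked , _) = contradiction (subst (_ <_) (childTail-unmarked c-unmarked) τb<τc) n≮0
    ... | inj₁ σc<σa with childTail-<-reflect b c τb<τc
    ...   | inj₁ σb<σc = inj₁ (a , b , c , (a<b , b<c) , σb<σc , σc<σa)
    ...   | inj₂ (b-unmarked , c-marked) = inj₂ (a , c , b , (<-trans a<b b<c , a<b) ,
      subst (_< lookup σ a) (proj₁ c-marked) σc<σa , c-marked , b-unmarked)

    child-210 : Contains210 (child σ Z) → Contains210 σ ⊎ MixedAfterNonzero σ Z
    child-210 (fzero , _ , _ , _ , _ , ())
    child-210 (fsuc _ , fzero , _ , (() , _) , _)
    child-210 (fsuc _ , fsuc _ , fzero , (_ , ()) , _)
    child-210 (fsuc a , fsuc b , fsuc c , (s≤s a<b , s≤s b<c) , τc<τb , τb<τa)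
      with childTail-<-reflect b a τb<τa
    ... | inj₂ (b-unmarked , _) = contradiction (subst (_ <_) (childTail-unmarked b-unmarked) τc<τb) n≮0
    ... | inj₁ σb<σa with childTail-<-reflect c b τc<τb
    ...   | inj₁ σc<σb = inj₁ (a , b , c , (a<b , b<c) , σc<σb , σb<σa)
    ...   | inj₂ (c-unmarked , b-marked) = inj₂ (a , b , c , (a<b , <-trans a<b b<c) ,
      subst (_< lookup σ a) (proj₁ b-marked) σb<σa , b-marked , c-unmarked)

onZeros : Bool → Vec ℕ n → Vec Bool n
onZeros c []          = []
onZeros c (zero ∷ σ)  = c ∷ onZeros c σ
onZeros c (suc _ ∷ σ) = false ∷ onZeros c σ

Uniform : Vec ℕ n → Vec Bool n → Set
Uniform σ Z = Z ≡ onZeros false σ ⊎ Z ≡ onZeros true σ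

uniform? : (σ : Vec ℕ n) (Z : Vec Bool n) → Dec (Uniform σ Z)
uniform? σ Z = (Z ≟ᵥ onZeros false σ) ⊎-dec (Z ≟ᵥ onZeros true σ)

Admissible : Vec ℕ n → Vec Bool n → Set
Admissible []          []          = ⊤
Admissible (zero ∷ σ)  (_ ∷ Z)     = Admissible σ Z
Admissible (suc _ ∷ σ) (false ∷ Z) = Uniform σ Z
Admissible (suc _ ∷ σ) (true ∷ Z)  = ⊥

admissible? : (σ : Vec ℕ n) (Z : Vec Bool n) → Dec (Admissible σ Z)
admissible? []          []          = yes tt
admissible? (zero ∷ σ)  (_ ∷ Z)     = admissible? σ Z
admissible? (suc _ ∷ σ) (false ∷ Z) = uniform? σ Z
admissible? (suc _ ∷ σ) (true ∷ Z)  = no id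

⊆-tail : SubsetOfZeros (x ∷ σ) (b ∷ Z) → SubsetOfZeros σ Z
⊆-tail Z⊆0 i = Z⊆0 (fsuc i)

marked-there : HasMarkedZero c σ Z → HasMarkedZero c (x ∷ σ) (b ∷ Z)
marked-there (i , marked) = fsuc i , marked

onZeros⊆zeros : ∀ c (σ : Vec ℕ n) → SubsetOfZeros σ (onZeros c σ)
onZeros⊆zeros c (zero ∷ σ)  fzero    _  = refl
onZeros⊆zeros c (zero ∷ σ)  (fsuc i)    = onZeros⊆zeros c σ i
onZeros⊆zeros c (suc _ ∷ σ) fzero    ()
onZeros⊆zeros c (suc _ ∷ σ) (fsuc i)    = onZeros⊆zeros c σ i

lookup-onZeros : ∀ c (σ : Vec ℕ n) i → lookup σ i ≡ 0 → lookup (onZeros c σ) i ≡ c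
lookup-onZeros c (zero ∷ σ)  fzero    _  = refl
lookup-onZeros c (zero ∷ σ)  (fsuc i)    = lookup-onZeros c σ i
lookup-onZeros c (suc _ ∷ σ) fzero    ()
lookup-onZeros c (suc _ ∷ σ) (fsuc i)    = lookup-onZeros c σ i

onZeros-marks : ∀ c (σ : Vec ℕ n) → HasMarkedZero c′ σ (onZeros c σ) → c′ ≡ c
onZeros-marks c σ (i , σi≡0 , marked) = trans (sym marked) (lookup-onZeros c σ i σi≡0)

≡onZeros : ∀ c (σ : Vec ℕ n) Z → SubsetOfZeros σ Z → ¬ HasMarkedZero (not c) σ Z →
  Z ≡ onZeros c σ
≡onZeros c []          []          _   _        = refl
≡onZeros c (zero ∷ σ)  (b ∷ Z)     Z⊆0 ¬marked = cong₂ _∷_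
  (trans (¬-not λ b≡¬c → ¬marked (fzero , refl , b≡¬c)) (not-involutive c))
  (≡onZeros c σ Z (⊆-tail Z⊆0) (¬marked ∘ marked-there))
≡onZeros c (suc _ ∷ σ) (true ∷ Z)  Z⊆0 _        = contradiction (Z⊆0 fzero refl) λ ()
≡onZeros c (suc _ ∷ σ) (false ∷ Z) Z⊆0 ¬marked =
  cong (false ∷_) (≡onZeros c σ Z (⊆-tail Z⊆0) (¬marked ∘ marked-there))

uniform⇒⊆ : Uniform σ Z → SubsetOfZeros σ Z
uniform⇒⊆ {σ = σ} (inj₁ refl) = onZeros⊆zeros false σ
uniform⇒⊆ {σ = σ} (inj₂ refl) = onZeros⊆zeros true σ

uniform⇒¬marked-both : Uniform σ Z → HasMarkedZero true σ Z → ¬ HasMarkedZero false σ Z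
uniform⇒¬marked-both {σ = σ} (inj₁ refl) t _ = contradiction (onZeros-marks false σ t) λ ()
uniform⇒¬marked-both {σ = σ} (inj₂ refl) _ f = contradiction (onZeros-marks true σ f) λ ()

uniform-or-marked-both : SubsetOfZeros σ Z →
  Uniform σ Z ⊎ HasMarkedZero true σ Z × HasMarkedZero false σ Z
uniform-or-marked-both {σ = σ} {Z} Z⊆0 with hasMarkedZero? true σ Z | hasMarkedZero? false σ Z
... | no ¬t | _     = inj₁ (inj₁ (≡onZeros false σ Z Z⊆0 ¬t))
... | yes _ | no ¬f = inj₁ (inj₂ (≡onZeros true σ Z Z⊆0 ¬f))
... | yes t | yes f = inj₂ (t , f)

mixed⇒marked-both : MixedAfterNonzero σ Z → HasMarkedZero true σ Z × HasMarkedZero false σ Z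
mixed⇒marked-both (_ , t , f , _ , _ , t-marked , f-unmarked) = (t , t-marked) , (f , f-unmarked)

mixed-∷ : MixedAfterNonzero (x ∷ σ) (b ∷ Z) ⇔
  (MixedAfterNonzero σ Z ⊎ 0 < x × HasMarkedZero true σ Z × HasMarkedZero false σ Z)
mixed-∷ = mk⇔
  (λ { (fzero , fzero , _ , (() , _) , _)
     ; (fzero , fsuc _ , fzero , (_ , ()) , _)
     ; (fzero , fsuc t , fsuc f , _ , 0<x , t-marked , f-unmarked) →
         inj₂ (0<x , (t , t-marked) , (f , f-unmarked))
     ; (fsuc _ , fzero , _ , (() , _) , _)
     ; (fsuc _ , fsuc _ , fzero , (_ , ()) , _)
     ; (fsuc a , fsuc t , fsuc f , (s≤s a<t , s≤s a<f) , rest) →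
         inj₁ (a , t , f , (a<t , a<f) , rest) })
  (λ { (inj₁ (a , t , f , (a<t , a<f) , rest)) → fsuc a , fsuc t , fsuc f , (s≤s a<t , s≤s a<f) , rest
     ; (inj₂ (0<x , (t , t-marked) , (f , f-unmarked))) →
         fzero , fsuc t , fsuc f , (s≤s z≤n , s≤s z≤n) , 0<x , t-marked , f-unmarked })

admissible⇒⊆ : ∀ (σ : Vec ℕ n) Z → Admissible σ Z → SubsetOfZeros σ Z
admissible⇒⊆ (zero ∷ σ)  (_ ∷ Z)     _   fzero    _  = refl
admissible⇒⊆ (zero ∷ σ)  (_ ∷ Z)     adm (fsuc i)    = admissible⇒⊆ σ Z adm i
admissible⇒⊆ (suc _ ∷ σ) (false ∷ Z) _   fzero    ()
admissible⇒⊆ (suc _ ∷ σ) (false ∷ Z) u   (fsuc i)    = uniform⇒⊆ u i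

admissible⇒¬mixed : ∀ (σ : Vec ℕ n) Z → Admissible σ Z → ¬ MixedAfterNonzero σ Z
admissible⇒¬mixed []          []          _   (() , _)
admissible⇒¬mixed (zero ∷ σ)  (_ ∷ Z)     adm mixed with Equivalence.to mixed-∷ mixed
... | inj₁ mixed′  = admissible⇒¬mixed σ Z adm mixed′
... | inj₂ (() , _)
admissible⇒¬mixed (suc _ ∷ σ) (false ∷ Z) u   mixed with Equivalence.to mixed-∷ mixed
... | inj₁ mixed′      =
  uncurry (uniform⇒¬marked-both {σ = σ} {Z} u) (mixed⇒marked-both {σ = σ} {Z} mixed′)
... | inj₂ (_ , t , f) = uniform⇒¬marked-both {σ = σ} {Z} u t f

⊆⇒admissible-or-mixed : ∀ (σ : Vec ℕ n) Z → SubsetOfZeros σ Z →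
  Admissible σ Z ⊎ MixedAfterNonzero σ Z
⊆⇒admissible-or-mixed []          []          _   = inj₁ tt
⊆⇒admissible-or-mixed (zero ∷ σ)  (_ ∷ Z)     Z⊆0 =
  map₂ (Equivalence.from mixed-∷ ∘ inj₁) (⊆⇒admissible-or-mixed σ Z (⊆-tail Z⊆0))
⊆⇒admissible-or-mixed (suc _ ∷ σ) (true ∷ Z)  Z⊆0 = contradiction (Z⊆0 fzero refl) λ ()
⊆⇒admissible-or-mixed (suc _ ∷ σ) (false ∷ Z) Z⊆0 =
  map₂ (λ (t , f) → Equivalence.from mixed-∷ (inj₂ (s≤s z≤n , t , f)))
       (uniform-or-marked-both (⊆-tail Z⊆0))

admissibleSubsets : Vec ℕ n → List (Vec Bool n)
admissibleSubsets σ = filter (admissible? σ) (allSubsets _)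

module _ {n} {σ : Vec ℕ n} (σ-avoids : Avoids201and210 σ) where

  avoiding-child≐admissible : (SubsetOfZeros σ ∩ λ Z → Avoids201and210 (child σ Z)) ≐ Admissible σ
  avoiding-child≐admissible = to , from
    where
    to : ∀ {Z} → SubsetOfZeros σ Z × Avoids201and210 (child σ Z) → Admissible σ Z
    to {Z} (Z⊆0 , ¬201 , ¬210) with ⊆⇒admissible-or-mixed σ Z Z⊆0
    ... | inj₁ adm   = adm
    ... | inj₂ mixed = contradiction (mixed⇒child-pattern {σ = σ} {Z} mixed) [ ¬201 , ¬210 ]

    from : ∀ {Z} → Admissible σ Z → SubsetOfZeros σ Z × Avoids201and210 (child σ Z)
    from {Z} adm = Z⊆0 ,
      [ proj₁ σ-avoids , ¬mixed ] ∘ child-201 {σ = σ} {Z} Z⊆0 ,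
      [ proj₂ σ-avoids , ¬mixed ] ∘ child-210 {σ = σ} {Z} Z⊆0
      where
      Z⊆0 : SubsetOfZeros σ Z
      Z⊆0 = admissible⇒⊆ σ Z adm
      ¬mixed : ¬ MixedAfterNonzero σ Z
      ¬mixed = admissible⇒¬mixed σ Z adm

  avoidingChildren-admissible : avoidingChildren σ ≡ map (child σ) (admissibleSubsets σ)
  avoidingChildren-admissible = begin
      filter avoids201and210? (map (child σ) (filter (subsetOfZeros? σ) S))
    ≡⟨ filter-map avoids201and210? (child σ) (filter (subsetOfZeros? σ) S) ⟩
      map (child σ) (filter (λ Z → avoids201and210? (child σ Z)) (filter (subsetOfZeros? σ) S))
    ≡⟨ cong (map (child σ)) (filter-filter (subsetOfZeros? σ) _ S) ⟩
      map (child σ) (filter (subsetOfZeros? σ ∩? λ Z → avoids201and210? (child σ Z)) S)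
    ≡⟨ cong (map (child σ)) (filter-≐ _ (admissible? σ) avoiding-child≐admissible S) ⟩
      map (child σ) (admissibleSubsets σ) ∎
    where
    open ≡-Reasoning
    S = allSubsets n

uniformSubsets : Vec ℕ n → List (Vec Bool n)
uniformSubsets σ = filter (uniform? σ) (allSubsets _)

uniformSubsets-zero∷ : ∀ (σ : Vec ℕ n) →
  uniformSubsets (0 ∷ σ) ≡ (false ∷ onZeros false σ) ∷ (true ∷ onZeros true σ) ∷ []
uniformSubsets-zero∷ {n} σ = trans (filter-allSubsets (uniform? (0 ∷ σ)))
  (cong₂ (λ xs ys → map (false ∷_) xs ++ map (true ∷_) ys) (branch false) (branch true))
  where
  head-fixes-colour : ∀ c → (λ Z → Uniform (0 ∷ σ) (c ∷ Z)) ≐ (_≡ onZeros c σ)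
  head-fixes-colour false = (λ { (inj₁ refl) → refl ; (inj₂ ()) }) , inj₁ ∘ cong (false ∷_)
  head-fixes-colour true  = (λ { (inj₁ ()) ; (inj₂ refl) → refl }) , inj₂ ∘ cong (true ∷_)
  branch : ∀ c → filter (λ Z → uniform? (0 ∷ σ) (c ∷ Z)) (allSubsets n) ≡ onZeros c σ ∷ []
  branch c = trans (filter-≐ _ (_≟ᵥ onZeros c σ) (head-fixes-colour c) (allSubsets n))
                   (filter-≟-allSubsets (onZeros c σ))

uniformSubsets-suc∷ : ∀ (σ : Vec ℕ n) →
  uniformSubsets (suc x ∷ σ) ≡ map (false ∷_) (uniformSubsets σ)
uniformSubsets-suc∷ {n} {x} σ =
  trans (filter-allSubsets-false (uniform? (suc x ∷ σ)) (λ _ → [ (λ ()) , (λ ()) ]))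
        (cong (map (false ∷_)) (filter-≐ _ (uniform? σ) tail-uniform (allSubsets n)))
  where
  tail-uniform : (λ Z → Uniform (suc x ∷ σ) (false ∷ Z)) ≐ Uniform σ
  tail-uniform = map-⊎ ∷-injectiveʳ ∷-injectiveʳ , map-⊎ (cong (false ∷_)) (cong (false ∷_))

admissibleSubsets-zero∷ : ∀ (σ : Vec ℕ n) →
  admissibleSubsets (0 ∷ σ) ≡
  map (false ∷_) (admissibleSubsets σ) ++ map (true ∷_) (admissibleSubsets σ)
admissibleSubsets-zero∷ σ = filter-allSubsets (admissible? (0 ∷ σ))

admissibleSubsets-suc∷ : ∀ (σ : Vec ℕ n) →
  admissibleSubsets (suc x ∷ σ) ≡ map (false ∷_) (uniformSubsets σ)
admissibleSubsets-suc∷ {x = x} σ = filter-allSubsets-false (admissible? (suc x ∷ σ)) (λ _ ())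

missesZero-onZeros-true : ∀ (σ : Vec ℕ n) → missesZero σ (onZeros true σ) ≡ 0
missesZero-onZeros-true []          = refl
missesZero-onZeros-true (zero ∷ σ)  =
  trans (χ-hasZero-suc∷ (childTail σ (onZeros true σ))) (missesZero-onZeros-true σ)
missesZero-onZeros-true (suc _ ∷ σ) =
  trans (χ-hasZero-suc∷ (childTail σ (onZeros true σ))) (missesZero-onZeros-true σ)

missesZero-uniformSubsets : ∀ (σ : Vec ℕ n) →
  map (missesZero σ) (uniformSubsets σ) ↭ 0 ∷ replicate (χ (hasZero? σ)) 1
missesZero-uniformSubsets []          = ↭-refl
missesZero-uniformSubsets (zero ∷ σ)  = begin
    map (missesZero (0 ∷ σ)) (uniformSubsets (0 ∷ σ))
  ≡⟨ cong (map (missesZero (0 ∷ σ))) (uniformSubsets-zero∷ σ) ⟩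
    missesZero (0 ∷ σ) (false ∷ onZeros false σ) ∷
    missesZero (0 ∷ σ) (true ∷ onZeros true σ) ∷ []
  ≡⟨ cong₂ (λ m m′ → m ∷ m′ ∷ [])
      (χ-hasZero-zero∷ (childTail σ (onZeros false σ)))
      (trans (χ-hasZero-suc∷ (childTail σ (onZeros true σ))) (missesZero-onZeros-true σ)) ⟩
    1 ∷ 0 ∷ []
  ↭⟨ swap 1 0 ↭-refl ⟩
    0 ∷ 1 ∷ []
  ≡⟨ cong (λ m → 0 ∷ replicate m 1) (sym (χ-hasZero-zero∷ σ)) ⟩
    0 ∷ replicate (χ (hasZero? (0 ∷ σ))) 1 ∎
  where open PermutationReasoning
missesZero-uniformSubsets (suc x ∷ σ) = begin
    map (missesZero (suc x ∷ σ)) (uniformSubsets (suc x ∷ σ))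
  ≡⟨ cong (map (missesZero (suc x ∷ σ))) (uniformSubsets-suc∷ {x = x} σ) ⟩
    map (missesZero (suc x ∷ σ)) (map (false ∷_) (uniformSubsets σ))
  ≡⟨ map-fusion (λ Z → χ-hasZero-suc∷ (childTail σ Z)) (uniformSubsets σ) ⟩
    map (missesZero σ) (uniformSubsets σ)
  ↭⟨ missesZero-uniformSubsets σ ⟩
    0 ∷ replicate (χ (hasZero? σ)) 1
  ≡⟨ cong (λ m → 0 ∷ replicate m 1) (sym (χ-hasZero-suc∷ σ)) ⟩
    0 ∷ replicate (χ (hasZero? (suc x ∷ σ))) 1 ∎
  where open PermutationReasoning

missesZero-admissibleSubsets : ∀ (σ : Vec ℕ n) →
  map (missesZero σ) (admissibleSubsets σ) ↭ 0 ∷ replicate (2 ^ s σ ∸ 1) 1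
missesZero-admissibleSubsets []          = ↭-refl
missesZero-admissibleSubsets (zero ∷ σ)  = begin
    map (missesZero (0 ∷ σ)) (admissibleSubsets (0 ∷ σ))
  ≡⟨ cong (map (missesZero (0 ∷ σ))) (admissibleSubsets-zero∷ σ) ⟩
    map (missesZero (0 ∷ σ)) (map (false ∷_) A ++ map (true ∷_) A)
  ≡⟨ map-++ (missesZero (0 ∷ σ)) (map (false ∷_) A) (map (true ∷_) A) ⟩
    map (missesZero (0 ∷ σ)) (map (false ∷_) A) ++ map (missesZero (0 ∷ σ)) (map (true ∷_) A)
  ≡⟨ cong₂ _++_ (trans (map-fusion (λ Z → χ-hasZero-zero∷ (childTail σ Z)) A) (map-∘ A))
                (map-fusion (λ Z → χ-hasZero-suc∷ (childTail σ Z)) A) ⟩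
    map (λ _ → 1) (map (missesZero σ) A) ++ map (missesZero σ) A
  ↭⟨ ++⁺ (map⁺ (λ _ → 1) (missesZero-admissibleSubsets σ)) (missesZero-admissibleSubsets σ) ⟩
    map (λ _ → 1) (0 ∷ replicate k 1) ++ 0 ∷ replicate k 1
  ≡⟨ cong (λ xs → (1 ∷ xs) ++ 0 ∷ replicate k 1) (map-replicate (λ _ → 1) k 1) ⟩
    (1 ∷ replicate k 1) ++ 0 ∷ replicate k 1
  ↭⟨ shift 0 (1 ∷ replicate k 1) (replicate k 1) ⟩
    0 ∷ replicate (suc k) 1 ++ replicate k 1
  ≡⟨ cong (0 ∷_) (++-replicate (suc k) k 1) ⟩
    0 ∷ replicate (suc k + k) 1
  ≡⟨ cong (λ m → 0 ∷ replicate m 1)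
         (sym (trans (cong (λ m → 2 ^ m ∸ 1) (s-zero∷ σ)) (2^suc∸1 (s σ)))) ⟩
    0 ∷ replicate (2 ^ s (0 ∷ σ) ∸ 1) 1 ∎
  where
  open PermutationReasoning
  A = admissibleSubsets σ
  k = 2 ^ s σ ∸ 1
missesZero-admissibleSubsets (suc x ∷ σ) = begin
    map (missesZero (suc x ∷ σ)) (admissibleSubsets (suc x ∷ σ))
  ≡⟨ cong (map (missesZero (suc x ∷ σ))) (admissibleSubsets-suc∷ {x = x} σ) ⟩
    map (missesZero (suc x ∷ σ)) (map (false ∷_) (uniformSubsets σ))
  ≡⟨ map-fusion (λ Z → χ-hasZero-suc∷ (childTail σ Z)) (uniformSubsets σ) ⟩
    map (missesZero σ) (uniformSubsets σ)
  ↭⟨ missesZero-uniformSubsets σ ⟩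
    0 ∷ replicate (χ (hasZero? σ)) 1
  ≡⟨ cong (λ m → 0 ∷ replicate m 1)
         (sym (trans (cong (λ m → 2 ^ m ∸ 1) (s-suc∷ σ)) (2^χ∸1 (hasZero? σ)))) ⟩
    0 ∷ replicate (2 ^ s (suc x ∷ σ) ∸ 1) 1 ∎
  where open PermutationReasoning

childLabels-admissibleSubsets : ∀ (σ : Vec ℕ n) →
  map (s ∘ child σ) (admissibleSubsets σ) ↭ production (s σ)
childLabels-admissibleSubsets []          = ↭-refl
childLabels-admissibleSubsets (zero ∷ σ)  = begin
    map (s ∘ child (0 ∷ σ)) (admissibleSubsets (0 ∷ σ))
  ≡⟨ cong (map (s ∘ child (0 ∷ σ))) (admissibleSubsets-zero∷ σ) ⟩
    map (s ∘ child (0 ∷ σ)) (map (false ∷_) A ++ map (true ∷_) A)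
  ≡⟨ map-++ (s ∘ child (0 ∷ σ)) (map (false ∷_) A) (map (true ∷_) A) ⟩
    map (s ∘ child (0 ∷ σ)) (map (false ∷_) A) ++ map (s ∘ child (0 ∷ σ)) (map (true ∷_) A)
  ≡⟨ cong₂ _++_ (trans (map-fusion (λ Z → s-zero∷ (child σ Z)) A) (map-∘ A))
                (trans (map-fusion (s-child-zero∷-true σ) A) (map-∘ A)) ⟩
    map suc (map (s ∘ child σ) A) ++ map suc (map (missesZero σ) A)
  ↭⟨ ++⁺ (map⁺ suc (childLabels-admissibleSubsets σ))
         (map⁺ suc (missesZero-admissibleSubsets σ)) ⟩
    map suc (production (s σ)) ++ map suc (0 ∷ replicate (2 ^ s σ ∸ 1) 1)
  ≡⟨ cong (λ xs → map suc (production (s σ)) ++ 1 ∷ xs) (map-replicate suc (2 ^ s σ ∸ 1) 1) ⟩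
    map suc (production (s σ)) ++ 1 ∷ replicate (2 ^ s σ ∸ 1) 2
  ↭⟨ production-suc (s σ) ⟩
    production (suc (s σ))
  ≡⟨ cong production (sym (s-zero∷ σ)) ⟩
    production (s (0 ∷ σ)) ∎
  where
  open PermutationReasoning
  A = admissibleSubsets σ
childLabels-admissibleSubsets (suc x ∷ σ) = begin
    map (s ∘ child (suc x ∷ σ)) (admissibleSubsets (suc x ∷ σ))
  ≡⟨ cong (map (s ∘ child (suc x ∷ σ))) (admissibleSubsets-suc∷ {x = x} σ) ⟩
    map (s ∘ child (suc x ∷ σ)) (map (false ∷_) (uniformSubsets σ))
  ≡⟨ trans (map-fusion (s-child-suc∷ {x = x} σ) (uniformSubsets σ)) (map-∘ (uniformSubsets σ)) ⟩
    map suc (map (missesZero σ) (uniformSubsets σ))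
  ↭⟨ map⁺ suc (missesZero-uniformSubsets σ) ⟩
    map suc (0 ∷ replicate (χ (hasZero? σ)) 1)
  ≡⟨ cong (1 ∷_) (map-replicate suc (χ (hasZero? σ)) 1) ⟩
    1 ∷ replicate (χ (hasZero? σ)) 2
  ≡⟨ sym (trans (cong production (s-suc∷ σ)) (production-χ (hasZero? σ))) ⟩
    production (s (suc x ∷ σ)) ∎
  where open PermutationReasoning

lemma3p2 : (s [] ≡ 0)
    × (∀ (n : ℕ) (σ : Vec ℕ n) → IsInversionSequence σ → Avoids201and210 σ →
         map s (avoidingChildren σ) ↭ production (s σ))
lemma3p2 = refl , λ n σ _ σ-avoids → begin
    map s (avoidingChildren σ)
      ≡⟨ cong (map s) (avoidingChildren-admissible {σ = σ} σ-avoids) ⟩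
    map s (map (child σ) (admissibleSubsets σ))
      ≡⟨ sym (map-∘ (admissibleSubsets σ)) ⟩
    map (s ∘ child σ) (admissibleSubsets σ)
      ↭⟨ childLabels-admissibleSubsets σ ⟩
    production (s σ) ∎
  where open PermutationReasoning
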